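{- Let $A$ be an $n\times m$ binary matrix with $R_{binary}(A)=k$ whose base graph (with respect to the binary rank) has at least two sources $U_1$ and $U_2$; regard each $U_i$ as an $n\times k$ binary matrix whose columns are the vectors of the base. Let $d\ge1$ and let $A''$ be the block matrix $$A''=\bigl(\,I_d\otimes A \;\big|\; I_d\otimes (U_1\,|\,U_2)\,\bigr),$$ i.e. $A$ repeated $d$ times along the block diagonal with zeros elsewhere, augmented by $d$ block-column groups, the $i$-th of which has $(U_1|U_2)$ in the $i$-th block row and zeros elsewhere. Then $R_{binary}(A'')\ge kd+d$.
   Context: A binary matrix has entries in $\{0,1\}$. $R_{binary}(M)$ is the minimal $r$ with $M=UV$, $U,V$ binary matrices with $r$ columns resp. rows, using ordinary arithmetic. A set $X$ of binary vectors spans a set $Y$ if every vector of $Y$ is the ordinary sum of some subset of $X$. A base of $A$ is a set of vectors in $\{0,1\}^n$ spanning all columns of $A$ of minimum cardinality among all such sets. The base graph of $A$ is the directed graph whose vertices are the bases of $A$, with an edge from $U$ to $V$ ($U\ne V$) if $U$ spans $V$; a source is a vertex with no incoming edge. $\otimes$ is the Kronecker (tensor) product and $I_d$ is the $d\times d$ identity matrix; $(B|C)$ denotes horizontal concatenation. -}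

module Defs where

open import Data.Nat using (ℕ; zero; suc; _+_; _*_; _≤_)
open import Data.Bool using (Bool; true; false; _∧_)
open import Data.Bool.Properties using ()
open import Data.Fin using (Fin; zero; suc; splitAt; remQuot; _≟_)
open import Data.Sum using (inj₁; inj₂)
open import Data.Product using (Σ; _×_; _,_; ∃)
open import Relation.Nullary using (¬_)
open import Relation.Nullary.Decidable using (isYes)
open import Relation.Binary.PropositionalEquality using (_≡_)

BVec : ℕ → Set
BVec n = Fin n → Bool

BMat : ℕ → ℕ → Set
BMat n m = Fin n → Fin m → Bool

⟦_⟧ : Bool → ℕ
⟦ false ⟧ = 0
⟦ true ⟧ = 1

∑ : ∀ {r} → (Fin r → ℕ) → ℕ
∑ {zero} f = 0
∑ {suc r} f = f zero + ∑ (λ l → f (suc l))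

-- M = U V with ordinary (integer) arithmetic, U : n×r, V : r×m binary
IsFactorization : ∀ {n m r} → BMat n m → BMat n r → BMat r m → Set
IsFactorization {n} {m} M U V =
  ∀ (i : Fin n) (j : Fin m) → ∑ (λ l → ⟦ U i l ⟧ * ⟦ V l j ⟧) ≡ ⟦ M i j ⟧

HasBinaryFact : ∀ {n m} → BMat n m → ℕ → Set
HasBinaryFact {n} {m} M r = Σ (BMat n r) λ U → Σ (BMat r m) λ V → IsFactorization M U V

RankBinaryIs : ∀ {n m} → BMat n m → ℕ → Set
RankBinaryIs M k = HasBinaryFact M k × (∀ r → HasBinaryFact M r → k ≤ r)

-- A finite set of s binary vectors, given by an injective enumeration X : Fin s → BVec n
-- (pointwise equality of vectors).
SameVec : ∀ {n} → BVec n → BVec n → Set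
SameVec u v = ∀ i → u i ≡ v i

InjectiveFam : ∀ {n s} → (Fin s → BVec n) → Set
InjectiveFam X = ∀ a b → SameVec (X a) (X b) → a ≡ b

SumOfSubset : ∀ {n s} → (Fin s → BVec n) → BVec n → Set
SumOfSubset {n} {s} X v =
  Σ (Fin s → Bool) λ S → ∀ i → ∑ (λ l → ⟦ S l ⟧ * ⟦ X l i ⟧) ≡ ⟦ v i ⟧

Spans : ∀ {n s t} → (Fin s → BVec n) → (Fin t → BVec n) → Set
Spans X Y = ∀ b → SumOfSubset X (Y b)

cols : ∀ {n m} → BMat n m → Fin m → BVec n
cols M j i = M i j

IsBase : ∀ {n m s} → BMat n m → (Fin s → BVec n) → Set
IsBase {n} {m} {s} A X =
  InjectiveFam X × Spans X (cols A) ×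
  (∀ t (Y : Fin t → BVec n) → InjectiveFam Y → Spans Y (cols A) → s ≤ t)

_∈F_ : ∀ {n s} → BVec n → (Fin s → BVec n) → Set
v ∈F X = ∃ λ l → SameVec (X l) v

SameSet : ∀ {n s t} → (Fin s → BVec n) → (Fin t → BVec n) → Set
SameSet X Y = (∀ a → X a ∈F Y) × (∀ b → Y b ∈F X)

-- U is a source of the base graph of A: a base with no incoming edge,
-- i.e. no base W different from U (as a set) spans U.
IsSource : ∀ {n m s} → BMat n m → (Fin s → BVec n) → Set
IsSource {n} A U =
  IsBase A U ×
  (∀ t (W : Fin t → BVec n) → IsBase A W → ¬ (¬ SameSet W U × Spans W U))

asMat : ∀ {n s} → (Fin s → BVec n) → BMat n s
asMat X i l = X l i

_∣∣_ : ∀ {n p q} → BMat n p → BMat n q → BMat n (p + q)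
_∣∣_ {p = p} B C i j with splitAt p j
... | inj₁ j₁ = B i j₁
... | inj₂ j₂ = C i j₂

-- Kronecker product I_d ⊗ M (rows indexed by (block, row), block-major)
I⊗ : ∀ d {n m} → BMat n m → BMat (d * n) (d * m)
I⊗ d {n} {m} M r c with remQuot {d} n r | remQuot {d} m c
... | (b , i) | (b' , j) = isYes (b ≟ b') ∧ M i j

-- In a factorisation A'' = X Y, a latent column l that feeds some column of A'' supported in
-- the b-th block of rows has its whole support in that block. Assigning each latent column to
-- the block containing its support, the columns assigned to block b therefore span, restricted
-- to that block, the columns of A, U₁ and U₂. A family spanning the columns of A has at least
-- k = R_binary(A) members; with exactly k it has no repeated vector (dropping a copy would leave
-- fewer than k), so it is a base, and a base spanning a source is that source: it would equal
-- both U₁ and U₂. Hence each of the d blocks receives at least k + 1 latent columns.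
module Submission where

open import Defs
open import Data.Nat using (ℕ; zero; suc; _+_; _*_; _≤_; _<_; z≤n; s≤s)
open import Data.Nat.Properties
  using (+-0-commutativeMonoid; +-comm; +-identityʳ; *-comm; *-identityʳ; *-zeroʳ;
         ≤-refl; ≤-trans; ≤-<-trans; <-irrefl; ≤∧≢⇒<; m≤m+n; m≤n+m; +-mono-≤; +-monoʳ-≤;
         module ≤-Reasoning)
open import Data.Bool using (Bool; true; false; _∧_; not)
open import Data.Bool.Properties using (∧-identityʳ) renaming (_≟_ to _≟ᵇ_)
open import Data.Fin using (Fin; zero; suc; remQuot; combine; _↑ˡ_; _↑ʳ_; _≟_)
open import Data.Fin.Properties using (any?; remQuot-combine; splitAt-↑ˡ; splitAt-↑ʳ)
open import Data.Fin.Permutation using (Permutation; transpose; _⟨$⟩ʳ_)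
open import Data.Maybe using (Maybe; just; nothing; maybe)
import Data.Maybe as Maybe
open import Data.Product using (Σ; _×_; _,_; proj₁; proj₂)
open import Data.Vec.Functional using (_∷_)
open import Function using (_∘_)
open import Relation.Nullary using (¬_; yes; no; contradiction)
open import Relation.Nullary.Decidable using (isYes; does; dec-true; dec⇒maybe)
open import Relation.Binary.PropositionalEquality
import Algebra.Properties.CommutativeMonoid.Sum as CommutativeMonoidSum

private
  module ℕ-Sum = CommutativeMonoidSum +-0-commutativeMonoid

∑≡sum : ∀ {r} (f : Fin r → ℕ) → ∑ f ≡ ℕ-Sum.sum f
∑≡sum {zero}  f = refl
∑≡sum {suc r} f = cong (f zero +_) (∑≡sum (f ∘ suc))

∑-cong : ∀ {r} {f g : Fin r → ℕ} → (∀ l → f l ≡ g l) → ∑ f ≡ ∑ g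
∑-cong {zero}  f≗g = refl
∑-cong {suc r} f≗g = cong₂ _+_ (f≗g zero) (∑-cong (f≗g ∘ suc))

∑-comm : ∀ {d r} (f : Fin d → Fin r → ℕ) →
  ∑ (λ b → ∑ (f b)) ≡ ∑ (λ l → ∑ (λ b → f b l))
∑-comm f = begin
  ∑ (λ b → ∑ (f b))                         ≡⟨ ∑-cong (∑≡sum ∘ f) ⟩
  ∑ (λ b → ℕ-Sum.sum (f b))                 ≡⟨ ∑≡sum (λ b → ℕ-Sum.sum (f b)) ⟩
  ℕ-Sum.sum (λ b → ℕ-Sum.sum (f b))         ≡⟨ ℕ-Sum.∑-comm f ⟩
  ℕ-Sum.sum (λ l → ℕ-Sum.sum (λ b → f b l)) ≡⟨ ∑≡sum (λ l → ℕ-Sum.sum (λ b → f b l)) ⟨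
  ∑ (λ l → ℕ-Sum.sum (λ b → f b l))         ≡⟨ ∑-cong (λ l → ∑≡sum (λ b → f b l)) ⟨
  ∑ (λ l → ∑ (λ b → f b l))                 ∎
  where open ≡-Reasoning

∑-permute : ∀ {r} (f : Fin r → ℕ) (π : Permutation r r) → ∑ f ≡ ∑ (f ∘ (π ⟨$⟩ʳ_))
∑-permute f π = trans (∑≡sum f) (trans (ℕ-Sum.∑-permute f π) (sym (∑≡sum (f ∘ (π ⟨$⟩ʳ_)))))

∑-const : ∀ {r} c → ∑ {r} (λ _ → c) ≡ r * c
∑-const {zero}  c = refl
∑-const {suc r} c = cong (c +_) (∑-const {r} c)

∑-mono : ∀ {r} {f g : Fin r → ℕ} → (∀ l → f l ≤ g l) → ∑ f ≤ ∑ g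
∑-mono {zero}  f≤g = z≤n
∑-mono {suc r} f≤g = +-mono-≤ (f≤g zero) (∑-mono (f≤g ∘ suc))

term≤∑ : ∀ {r} (f : Fin r → ℕ) l → f l ≤ ∑ f
term≤∑ f zero    = m≤m+n (f zero) _
term≤∑ f (suc l) = ≤-trans (term≤∑ (f ∘ suc) l) (m≤n+m _ (f zero))

twoTerms≤∑ : ∀ {r} (f : Fin r → ℕ) {a b} → a ≢ b → f a + f b ≤ ∑ f
twoTerms≤∑ f {zero}  {zero}  a≢b = contradiction refl a≢b
twoTerms≤∑ f {zero}  {suc b} a≢b = +-monoʳ-≤ (f zero) (term≤∑ (f ∘ suc) b)
twoTerms≤∑ f {suc a} {zero}  a≢b =
  subst (_≤ ∑ f) (+-comm (f zero) (f (suc a))) (+-monoʳ-≤ (f zero) (term≤∑ (f ∘ suc) a))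
twoTerms≤∑ f {suc a} {suc b} a≢b =
  ≤-trans (twoTerms≤∑ (f ∘ suc) (a≢b ∘ cong suc)) (m≤n+m _ (f zero))

⟦⟧≤1 : ∀ x → ⟦ x ⟧ ≤ 1
⟦⟧≤1 false = z≤n
⟦⟧≤1 true  = s≤s z≤n

∧-elimˡ : ∀ {x y} → x ∧ y ≡ true → x ≡ true
∧-elimˡ {true} _ = refl

∧-elimʳ : ∀ {x y} → x ∧ y ≡ true → y ≡ true
∧-elimʳ {true} x∧y≡true = x∧y≡true

isYes-≟-refl : ∀ {d} (a : Fin d) → isYes (a ≟ a) ≡ true
isYes-≟-refl a with a ≟ a
... | yes _  = refl
... | no a≢a = contradiction refl a≢a

isYes-≟-sound : ∀ {d} {a b : Fin d} → isYes (a ≟ b) ≡ true → a ≡ b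
isYes-≟-sound {a = a} {b} a≟b≡true with a ≟ b
... | yes a≡b = a≡b
... | no  _   = contradiction a≟b≡true λ ()

count : ∀ {r} → (Fin r → Bool) → ℕ
count M = ∑ (λ l → ⟦ M l ⟧)

count≤ : ∀ {r} (M : Fin r → Bool) → count M ≤ r
count≤ {zero}  M = z≤n
count≤ {suc r} M = +-mono-≤ (⟦⟧≤1 (M zero)) (count≤ (M ∘ suc))

count< : ∀ {r} (M : Fin r → Bool) {b} → M b ≡ false → count M < r
count< {suc r} M {zero}  Mb≡false rewrite Mb≡false = s≤s (count≤ (M ∘ suc))
count< {suc r} M {suc b} Mb≡false =
  ≤-trans (s≤s (+-mono-≤ (⟦⟧≤1 (M zero)) ≤-refl)) (s≤s (count< (M ∘ suc) Mb≡false))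

enum : ∀ {r} (M : Fin r → Bool) → Fin (count M) → Fin r
enum {zero}  M ()
enum {suc r} M = extend (M zero) (enum (M ∘ suc))
  where
  extend : ∀ x → (Fin (count (M ∘ suc)) → Fin r) → Fin (⟦ x ⟧ + count (M ∘ suc)) → Fin (suc r)
  extend true  e = zero ∷ (suc ∘ e)
  extend false e = suc ∘ e

∑-enum : ∀ {r} (M : Fin r → Bool) (f : Fin r → ℕ) →
  ∑ (λ l → ⟦ M l ⟧ * f l) ≡ ∑ (f ∘ enum M)
∑-enum {zero}  M f = refl
∑-enum {suc r} M f with M zero | ∑-enum (M ∘ suc) (f ∘ suc)
... | true  | ih = cong₂ _+_ (+-identityʳ (f zero)) ih
... | false | ih = ih

SumOfSubsetWithin : ∀ {n r} → (Fin r → BVec n) → (Fin r → Bool) → BVec n → Set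
SumOfSubsetWithin {n} {r} Z M v =
  Σ (Fin r → Bool) λ S → (∀ l → S l ≡ true → M l ≡ true) ×
    (∀ i → ∑ (λ l → ⟦ S l ⟧ * ⟦ Z l i ⟧) ≡ ⟦ v i ⟧)

sumOfSubset-enum : ∀ {n r} {Z : Fin r → BVec n} {M v} →
  SumOfSubsetWithin Z M v → SumOfSubset (Z ∘ enum M) v
sumOfSubset-enum {Z = Z} {M} {v} (S , S⊆M , ΣSZ≡v) = S ∘ enum M , λ i → begin
  ∑ (λ j → ⟦ S (enum M j) ⟧ * ⟦ Z (enum M j) i ⟧) ≡⟨ ∑-enum M (λ l → ⟦ S l ⟧ * ⟦ Z l i ⟧) ⟨
  ∑ (λ l → ⟦ M l ⟧ * (⟦ S l ⟧ * ⟦ Z l i ⟧))       ≡⟨ ∑-cong (λ l → masked ⟦ Z l i ⟧ (S⊆M l)) ⟩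
  ∑ (λ l → ⟦ S l ⟧ * ⟦ Z l i ⟧)                   ≡⟨ ΣSZ≡v i ⟩
  ⟦ v i ⟧                                         ∎
  where
  open ≡-Reasoning
  masked : ∀ {s x} z → (s ≡ true → x ≡ true) → ⟦ x ⟧ * (⟦ s ⟧ * z) ≡ ⟦ s ⟧ * z
  masked {false} {x} z _ = *-zeroʳ ⟦ x ⟧
  masked {true}        z s⊆x rewrite s⊆x refl = +-identityʳ (z + 0)

without : ∀ {c} → Fin c → Fin c → Bool
without b l = not (isYes (l ≟ b))

without-self : ∀ {c} (b : Fin c) → without b b ≡ false
without-self b = cong not (isYes-≟-refl b)

⊆-without : ∀ {c} {S : Fin c → Bool} {b} → S b ≡ false → ∀ l → S l ≡ true → without b l ≡ true
⊆-without {b = b} Sb≡false l Sl≡true with l ≟ b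
... | yes refl = contradiction (trans (sym Sb≡false) Sl≡true) λ ()
... | no _     = refl

transpose-self : ∀ {c} (b a : Fin c) → transpose b a ⟨$⟩ʳ b ≡ a
transpose-self b a rewrite dec-true (b ≟ b) refl = refl

transpose-duplicate : ∀ {n c} (Z : Fin c → BVec n) {a b} → SameVec (Z a) (Z b) →
  ∀ l → SameVec (Z (transpose b a ⟨$⟩ʳ l)) (Z l)
transpose-duplicate Z {a} {b} Za≐Zb l with l ≟ b
... | yes refl = Za≐Zb
... | no _ with l ≟ a
...   | yes refl = λ i → sym (Za≐Zb i)
...   | no _     = λ _ → refl

-- A subset sum using both copies of a repeated vector is at most 1 in every coordinate,
-- so that vector is zero and its second copy can be dropped; using only the second copy,
-- exchange it for the first.
sumOfSubset-without-duplicate : ∀ {n c} (Z : Fin c → BVec n) {a b} → a ≢ b →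
  SameVec (Z a) (Z b) → ∀ {v} → SumOfSubset Z v → SumOfSubsetWithin Z (without b) v
sumOfSubset-without-duplicate Z {a} {b} a≢b Za≐Zb {v} (S , ΣSZ≡v) with S b in Sb | S a in Sa
... | false | _    = S , ⊆-without Sb , ΣSZ≡v
... | true  | false = S ∘ τ , ⊆-without (trans (cong S (transpose-self b a)) Sa) , swapped
  where
  τ = transpose b a ⟨$⟩ʳ_
  swapped : ∀ i → ∑ (λ l → ⟦ S (τ l) ⟧ * ⟦ Z l i ⟧) ≡ ⟦ v i ⟧
  swapped i = begin
    ∑ (λ l → ⟦ S (τ l) ⟧ * ⟦ Z l i ⟧)     ≡⟨ ∑-cong (λ l → cong (λ z → ⟦ S (τ l) ⟧ * ⟦ z ⟧)
                                                   (transpose-duplicate Z Za≐Zb l i)) ⟨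
    ∑ (λ l → ⟦ S (τ l) ⟧ * ⟦ Z (τ l) i ⟧) ≡⟨ ∑-permute (λ l → ⟦ S l ⟧ * ⟦ Z l i ⟧) (transpose b a) ⟨
    ∑ (λ l → ⟦ S l ⟧ * ⟦ Z l i ⟧)         ≡⟨ ΣSZ≡v i ⟩
    ⟦ v i ⟧                               ∎
    where open ≡-Reasoning
... | true  | true  = (λ l → S l ∧ without b l) , (λ _ → ∧-elimʳ) , dropped
  where
  Zb≡0 : ∀ i → Z b i ≡ false
  Zb≡0 i with Z b i in Zbi | twoTerms≤∑ (λ l → ⟦ S l ⟧ * ⟦ Z l i ⟧) a≢b
  ... | false | _     = refl
  ... | true  | bound rewrite Sa | Sb | Za≐Zb i | Zbi | ΣSZ≡v i =
    contradiction (≤-trans bound (⟦⟧≤1 (v i))) λ { (s≤s ()) }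
  dropTerm : ∀ i l → ⟦ S l ∧ without b l ⟧ * ⟦ Z l i ⟧ ≡ ⟦ S l ⟧ * ⟦ Z l i ⟧
  dropTerm i l with l ≟ b
  ... | yes refl rewrite Sb | Zb≡0 i = refl
  ... | no _     rewrite ∧-identityʳ (S l) = refl
  dropped : ∀ i → ∑ (λ l → ⟦ S l ∧ without b l ⟧ * ⟦ Z l i ⟧) ≡ ⟦ v i ⟧
  dropped i = trans (∑-cong (dropTerm i)) (ΣSZ≡v i)

SameSet-sym : ∀ {n s t} {X : Fin s → BVec n} {Y : Fin t → BVec n} → SameSet X Y → SameSet Y X
SameSet-sym (X⊆Y , Y⊆X) = Y⊆X , X⊆Y

SameSet-trans : ∀ {n s t u} {X : Fin s → BVec n} {Y : Fin t → BVec n} {W : Fin u → BVec n} →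
  SameSet X Y → SameSet Y W → SameSet X W
SameSet-trans (X⊆Y , Y⊆X) (Y⊆W , W⊆Y) = ⊆-trans X⊆Y Y⊆W , ⊆-trans W⊆Y Y⊆X
  where
  ⊆-trans : ∀ {s t u} {X : Fin s → BVec _} {Y : Fin t → BVec _} {W : Fin u → BVec _} →
    (∀ a → X a ∈F Y) → (∀ b → Y b ∈F W) → ∀ a → X a ∈F W
  ⊆-trans X⊆Y Y⊆W a with X⊆Y a
  ... | l , Yl≐Xa with Y⊆W l
  ...   | l′ , Wl′≐Yl = l′ , λ i → trans (Wl′≐Yl i) (Yl≐Xa i)

injective-unless-duplicate : ∀ {n c} (Z : Fin c → BVec n) →
  (∀ {a b} → a ≢ b → ¬ SameVec (Z a) (Z b)) → InjectiveFam Z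
injective-unless-duplicate Z noDuplicate a b Za≐Zb with a ≟ b
... | yes a≡b = a≡b
... | no  a≢b = contradiction Za≐Zb (noDuplicate a≢b)

spans⇒hasBinaryFact : ∀ {n m c} (A : BMat n m) (Z : Fin c → BVec n) →
  Spans Z (cols A) → HasBinaryFact A c
spans⇒hasBinaryFact A Z spans =
  asMat Z , (λ l j → proj₁ (spans j) l) ,
  λ i j → trans (∑-cong (λ l → *-comm ⟦ Z l i ⟧ ⟦ proj₁ (spans j) l ⟧)) (proj₂ (spans j) i)

module _ {n m k} {A : BMat n m} (rank : RankBinaryIs A k) where

  rank≤size : ∀ {c} {Z : Fin c → BVec n} → Spans Z (cols A) → k ≤ c
  rank≤size {Z = Z} spans = proj₂ rank _ (spans⇒hasBinaryFact A Z spans)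

  duplicate⇒rank<size : ∀ {c} {Z : Fin c → BVec n} {a b} → a ≢ b → SameVec (Z a) (Z b) →
    Spans Z (cols A) → k < c
  duplicate⇒rank<size {Z = Z} {b = b} a≢b Za≐Zb spans =
    ≤-<-trans (rank≤size spansWithout) (count< (without b) (without-self b))
    where
    spansWithout : Spans (Z ∘ enum (without b)) (cols A)
    spansWithout j = sumOfSubset-enum (sumOfSubset-without-duplicate Z a≢b Za≐Zb (spans j))

  injective-spanning-of-rank-size⇒base : ∀ {c} {Z : Fin c → BVec n} → c ≡ k →
    InjectiveFam Z → Spans Z (cols A) → IsBase A Z
  injective-spanning-of-rank-size⇒base refl injective spans =
    injective , spans , λ _ _ _ → rank≤size

  spans-two-sources⇒rank<size : ∀ {U₁ U₂ : Fin k → BVec n} →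
    IsSource A U₁ → IsSource A U₂ → ¬ SameSet U₁ U₂ →
    ∀ {c} {Z : Fin c → BVec n} → Spans Z (cols A) → Spans Z U₁ → Spans Z U₂ → k < c
  spans-two-sources⇒rank<size (_ , source₁) (_ , source₂) U₁≉U₂ {c} {Z} spansA spans₁ spans₂ =
    ≤∧≢⇒< (rank≤size spansA) k≢c
    where
    k≢c : k ≢ c
    k≢c k≡c = source₁ c Z base ((λ Z≈U₁ → source₂ c Z base
      ((λ Z≈U₂ → U₁≉U₂ (SameSet-trans (SameSet-sym Z≈U₁) Z≈U₂)) , spans₂)) , spans₁)
      where
      base : IsBase A Z
      base = injective-spanning-of-rank-size⇒base (sym k≡c)
        (injective-unless-duplicate Z λ a≢b Za≐Zb →
          <-irrefl k≡c (duplicate⇒rank<size a≢b Za≐Zb spansA))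
        spansA

block : ∀ {d} n → Fin (d * n) → Fin d
block n ρ = proj₁ (remQuot n ρ)

BlockColumn : ∀ {d n q} → BMat (d * n) q → Fin d → BVec n → Fin q → Set
BlockColumn {d} {n} M b w c =
  (∀ ρ → M ρ c ≡ true → block {d} n ρ ≡ b) × (∀ i → M (combine b i) c ≡ w i)

I⊗-combine : ∀ d {n m} (B : BMat n m) ρ b j →
  I⊗ d B ρ (combine b j) ≡ isYes (block {d} n ρ ≟ b) ∧ B (proj₂ (remQuot {d} n ρ)) j
I⊗-combine d {n} B ρ b j =
  cong (λ (b′ , j′) → isYes (block {d} n ρ ≟ b′) ∧ B (proj₂ (remQuot {d} n ρ)) j′)
       (remQuot-combine b j)

I⊗-blockColumn : ∀ d {n m} (B : BMat n m) b j {w : BVec n} → (∀ i → B i j ≡ w i) →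
  BlockColumn (I⊗ d B) b w (combine b j)
I⊗-blockColumn d {n} B b j {w} Bj≐w =
  (λ ρ entry → isYes-≟-sound (∧-elimˡ (trans (sym (I⊗-combine d B ρ b j)) entry))) ,
  λ i → begin
    I⊗ d B (combine b i) (combine b j) ≡⟨ I⊗-combine d B (combine b i) b j ⟩
    isYes (block {d} n (combine b i) ≟ b) ∧ B (proj₂ (remQuot {d} n (combine b i))) j
      ≡⟨ cong (λ (b′ , i′) → isYes (b′ ≟ b) ∧ B i′ j) (remQuot-combine b i) ⟩
    isYes (b ≟ b) ∧ B i j              ≡⟨ cong (_∧ B i j) (isYes-≟-refl b) ⟩
    B i j                              ≡⟨ Bj≐w i ⟩
    w i                                ∎
  where open ≡-Reasoning

∣∣-↑ˡ : ∀ {n p q} (B : BMat n p) (C : BMat n q) i j → (B ∣∣ C) i (j ↑ˡ q) ≡ B i j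
∣∣-↑ˡ {p = p} {q} B C i j rewrite splitAt-↑ˡ p j q = refl

∣∣-↑ʳ : ∀ {n p q} (B : BMat n p) (C : BMat n q) i j → (B ∣∣ C) i (p ↑ʳ j) ≡ C i j
∣∣-↑ʳ {p = p} {q} B C i j rewrite splitAt-↑ʳ p q j = refl

BlockColumn-∣∣ˡ : ∀ {d n p q} {B : BMat (d * n) p} (C : BMat (d * n) q) {b w c} →
  BlockColumn {d} {n} B b w c → BlockColumn {d} {n} (B ∣∣ C) b w (c ↑ˡ q)
BlockColumn-∣∣ˡ {B = B} C {b} {c = c} (support⊆b , values) =
  (λ ρ entry → support⊆b ρ (trans (sym (∣∣-↑ˡ B C ρ c)) entry)) ,
  (λ i → trans (∣∣-↑ˡ B C (combine b i) c) (values i))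

BlockColumn-∣∣ʳ : ∀ {d n p q} (B : BMat (d * n) p) {C : BMat (d * n) q} {b w c} →
  BlockColumn {d} {n} C b w c → BlockColumn {d} {n} (B ∣∣ C) b w (p ↑ʳ c)
BlockColumn-∣∣ʳ B {C} {b} {c = c} (support⊆b , values) =
  (λ ρ entry → support⊆b ρ (trans (sym (∣∣-↑ʳ B C ρ c)) entry)) ,
  (λ i → trans (∣∣-↑ʳ B C (combine b i) c) (values i))

-- Uses does rather than isYes so that does (suc a ≟ suc b) computes to does (a ≟ b).
indicator : ∀ {d} → Maybe (Fin d) → Fin d → Bool
indicator x b = maybe (λ a → does (a ≟ b)) false x

count-≟ : ∀ {d} (a : Fin d) → count (λ b → does (a ≟ b)) ≡ 1
count-≟ {suc d} zero    = cong suc (trans (∑-const {d} 0) (*-zeroʳ d))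
count-≟ {suc d} (suc a) = count-≟ a

count-indicator≤1 : ∀ {d} (x : Maybe (Fin d)) → count (indicator x) ≤ 1
count-indicator≤1 {d} nothing  = subst (_≤ 1) (sym (trans (∑-const {d} 0) (*-zeroʳ d))) z≤n
count-indicator≤1     (just a) = subst (_≤ 1) (sym (count-≟ a)) ≤-refl

∑-count-fibres≤ : ∀ {d r} (β : Fin r → Maybe (Fin d)) →
  ∑ (λ b → count (λ l → indicator (β l) b)) ≤ r
∑-count-fibres≤ {d} {r} β = begin
  ∑ (λ b → count (λ l → indicator (β l) b)) ≡⟨ ∑-comm (λ b l → ⟦ indicator (β l) b ⟧) ⟩
  ∑ (λ l → count (indicator (β l)))         ≤⟨ ∑-mono (count-indicator≤1 ∘ β) ⟩
  ∑ {r} (λ _ → 1)                           ≡⟨ ∑-const {r} 1 ⟩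
  r * 1                                     ≡⟨ *-identityʳ r ⟩
  r                                         ∎
  where open ≤-Reasoning

factors⇒entry : ∀ {n m r} {M : BMat n m} {X : BMat n r} {Y : BMat r m} →
  IsFactorization M X Y → ∀ {ρ l c} → X ρ l ≡ true → Y l c ≡ true → M ρ c ≡ true
factors⇒entry {M = M} {X} {Y} fact {ρ} {l} {c} Xρl Ylc
  with M ρ c in Mρc | term≤∑ (λ l′ → ⟦ X ρ l′ ⟧ * ⟦ Y l′ c ⟧) l
... | true  | _     = refl
... | false | bound rewrite fact ρ c | Mρc | Xρl | Ylc = contradiction bound λ ()

module BlockSupport {d n r} (X : BMat (d * n) r) where

  -- The choice of block is arbitrary when the support of l meets several blocks;
  -- such an l contributes to no column supported in a single block.
  supportBlock : Fin r → Maybe (Fin d)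
  supportBlock l = Maybe.map (block n ∘ proj₁) (dec⇒maybe (any? λ ρ → X ρ l ≟ᵇ true))

  inBlock : Fin d → Fin r → Bool
  inBlock b l = indicator (supportBlock l) b

  blockRows : Fin d → Fin r → BVec n
  blockRows b l i = X (combine b i) l

  inBlock-intro : ∀ {b l ρ} → X ρ l ≡ true →
    (∀ ρ′ → X ρ′ l ≡ true → block n ρ′ ≡ b) → inBlock b l ≡ true
  inBlock-intro {b} {l} {ρ} Xρl support⊆b with any? (λ ρ → X ρ l ≟ᵇ true)
  ... | yes (ρ′ , Xρ′l) rewrite support⊆b ρ′ Xρ′l = dec-true (b ≟ b) refl
  ... | no  noSupport   = contradiction (ρ , Xρl) noSupport

  blockColumn⇒sumOfSubsetWithin : ∀ {q} {M : BMat (d * n) q} {Y : BMat r q} →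
    IsFactorization M X Y → ∀ {b w c} → BlockColumn M b w c →
    SumOfSubsetWithin (blockRows b) (inBlock b) w
  blockColumn⇒sumOfSubsetWithin {Y = Y} fact {b} {w} {c} (support⊆b , values) =
    (λ l → Y l c ∧ inBlock b l) , (λ _ → ∧-elimʳ) ,
    λ i → trans (∑-cong (term i)) (trans (fact (combine b i) c) (cong ⟦_⟧ (values i)))
    where
    term : ∀ i l →
      ⟦ Y l c ∧ inBlock b l ⟧ * ⟦ X (combine b i) l ⟧ ≡ ⟦ X (combine b i) l ⟧ * ⟦ Y l c ⟧
    term i l with X (combine b i) l in Xil | Y l c in Ylc
    ... | true  | true  rewrite inBlock-intro Xil λ ρ Xρl →
                          support⊆b ρ (factors⇒entry {X = X} {Y} fact Xρl Ylc) = refl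
    ... | true  | false = refl
    ... | false | y     = *-zeroʳ ⟦ y ∧ inBlock b l ⟧

  blockColumns⇒spans : ∀ {q} {M : BMat (d * n) q} {Y : BMat r q} → IsFactorization M X Y →
    ∀ {b t} {W : Fin t → BVec n} (col : Fin t → Fin q) → (∀ j → BlockColumn M b (W j) (col j)) →
    Spans (blockRows b ∘ enum (inBlock b)) W
  blockColumns⇒spans fact col blockColumn j =
    sumOfSubset-enum (blockColumn⇒sumOfSubsetWithin fact (blockColumn j))

mainTheorem19 : ∀ {n m k d : ℕ} (A : BMat n m) (U₁ U₂ : Fin k → BVec n) →
    RankBinaryIs A k →
    IsSource A U₁ → IsSource A U₂ → ¬ SameSet U₁ U₂ →
    1 ≤ d →
    ∀ r → HasBinaryFact (I⊗ d A ∣∣ I⊗ d (asMat U₁ ∣∣ asMat U₂)) r →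
    k * d + d ≤ r
mainTheorem19 {n} {m} {k} {d} A U₁ U₂ rank source₁ source₂ U₁≉U₂ _ r (X , Y , fact) = begin
  k * d + d                      ≡⟨ trans (+-comm (k * d) d) (*-comm (suc k) d) ⟩
  d * suc k                      ≡⟨ ∑-const {d} (suc k) ⟨
  ∑ {d} (λ _ → suc k)            ≤⟨ ∑-mono blockExceedsRank ⟩
  ∑ (λ b → count (inBlock b))    ≤⟨ ∑-count-fibres≤ supportBlock ⟩
  r                              ∎
  where
  open ≤-Reasoning
  open BlockSupport {d} {n} X
  U₁₂ = asMat U₁ ∣∣ asMat U₂
  blockExceedsRank : ∀ b → suc k ≤ count (inBlock b)
  blockExceedsRank b = spans-two-sources⇒rank<size rank source₁ source₂ U₁≉U₂
    (blockColumns⇒spans fact (λ j → combine b j ↑ˡ d * (k + k)) λ j →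
      BlockColumn-∣∣ˡ {B = I⊗ d A} (I⊗ d U₁₂) (I⊗-blockColumn d A b j λ _ → refl))
    (blockColumns⇒spans fact (λ j → d * m ↑ʳ combine b (j ↑ˡ k)) λ j →
      BlockColumn-∣∣ʳ (I⊗ d A) (I⊗-blockColumn d U₁₂ b (j ↑ˡ k) λ i →
        ∣∣-↑ˡ (asMat U₁) (asMat U₂) i j))
    (blockColumns⇒spans fact (λ j → d * m ↑ʳ combine b (k ↑ʳ j)) λ j →
      BlockColumn-∣∣ʳ (I⊗ d A) (I⊗-blockColumn d U₁₂ b (k ↑ʳ j) λ i →
        ∣∣-↑ʳ (asMat U₁) (asMat U₂) i j))
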